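{- Let $q\ge3$, $n\ge1$, and let $(T_+,T_-)$ be a pair of disjoint subsets of $\mathbb{Z}_q^n$ with characteristic $(0,\pm1)$-function $f$. Then the following are equivalent: (D1) $T_+$ and $T_-$ are codes with code distance $4$, and there is a matrix $F$ with $q^n$ rows indexed by the vertices of $H(n,q)$ and $3$ columns such that the first column of $F$ is $f$, each row of $F$ has entry sum $0$ and at most $2$ nonzero entries, and $AF=FS$, where $A$ is the adjacency matrix of $H(n,q)$ and $$S=\begin{pmatrix}0 & n(q-1) & 0\\ 1 & q-2 & (n-1)(q-1)\\ 0 & n & n(q-2)\end{pmatrix};$$ (D3) for every vertex $x$ of $H(n,q)$, $w_{T_+}(x)=w_{T_- }(x)\le1$.
   Context: $H(n,q)$ is the Hamming graph on $\mathbb{Z}_q^n$ (adjacent iff differing in exactly one coordinate), $d$ the Hamming distance, $S_i(x)=\{y:d(x,y)=i\}$. A set of vertices is a code with code distance $d$ if any two distinct elements are at distance at least $d$. The characteristic $(0,\pm1)$-function of $(T_+,T_-)$ is $1$ on $T_+$, $-1$ on $T_-$, $0$ elsewhere. For $Z\subseteq\mathbb{Z}_q^n$, $w_Z(x)=|S_0(x)\cap Z|+|S_1(x)\cap Z|+\frac{2}{n}|S_2(x)\cap Z|$. -}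

module Defs where

open import Data.Nat as ℕ using (ℕ; zero; suc; _∸_; NonZero)
import Data.Nat.Properties as ℕP
open import Data.Integer using (+_)
open import Data.Fin using (Fin; zero; suc)
import Data.Fin.Properties as FinP
open import Data.Vec using (Vec; []; _∷_)
open import Data.List using (List; []; _∷_; map; concatMap; allFin; filter; length; foldr; filterᵇ)
open import Data.Bool using (Bool; true; false; _∧_; if_then_else_)
open import Data.Rational using (ℚ; 0ℚ; 1ℚ; _+_; _*_; _/_; -_)
open import Data.Rational.Properties using (_≟_)
open import Relation.Nullary.Decidable using (⌊_⌋; ¬?)

Vertex : ℕ → ℕ → Set
Vertex n q = Vec (Fin q) n

allV : (n q : ℕ) → List (Vertex n q)
allV zero q = [] ∷ []
allV (suc n) q = concatMap (λ a → map (a ∷_) (allV n q)) (allFin q)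

dist : ∀ {n q} → Vertex n q → Vertex n q → ℕ
dist [] [] = 0
dist (a ∷ x) (b ∷ y) = (if ⌊ a FinP.≟ b ⌋ then 0 else 1) ℕ.+ dist x y

VSet : ℕ → ℕ → Set
VSet n q = Vertex n q → Bool

countSphere : ∀ {n q} → VSet n q → ℕ → Vertex n q → ℕ
countSphere {n} {q} Z i x =
  length (filterᵇ (λ y → ⌊ dist x y ℕP.≟ i ⌋ ∧ Z y) (allV n q))

ℕtoℚ : ℕ → ℚ
ℕtoℚ k = + k / 1

w : ∀ {n q} .{{_ : NonZero n}} → VSet n q → Vertex n q → ℚ
w {n} Z x = ℕtoℚ (countSphere Z 0 x) + ℕtoℚ (countSphere Z 1 x)
            + (+ (2 ℕ.* countSphere Z 2 x)) / n

IsCode : ∀ {n q} → VSet n q → ℕ → Set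
IsCode T d = ∀ x y → T x ≡ true → T y ≡ true → x ≢ y → d ℕ.≤ dist x y
  where open import Relation.Binary.PropositionalEquality using (_≡_; _≢_)

Disjoint : ∀ {n q} → VSet n q → VSet n q → Set
Disjoint T₊ T₋ = ∀ x → T₊ x ≡ true → T₋ x ≡ true → ⊥
  where open import Relation.Binary.PropositionalEquality using (_≡_)
        open import Data.Empty using (⊥)

charFun : ∀ {n q} → VSet n q → VSet n q → Vertex n q → ℚ
charFun T₊ T₋ x = if T₊ x then 1ℚ else (if T₋ x then - 1ℚ else 0ℚ)

Mat3 : ℕ → ℕ → Set
Mat3 n q = Vertex n q → Fin 3 → ℚ

sumℚ : List ℚ → ℚ
sumℚ = foldr _+_ 0ℚ

AF : ∀ {n q} → Mat3 n q → Vertex n q → Fin 3 → ℚ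
AF {n} {q} F x j =
  sumℚ (map (λ y → F y j) (filterᵇ (λ y → ⌊ dist x y ℕP.≟ 1 ⌋) (allV n q)))

Smat : ℕ → ℕ → Fin 3 → Fin 3 → ℚ
Smat n q zero zero = 0ℚ
Smat n q zero (suc zero) = ℕtoℚ (n ℕ.* (q ∸ 1))
Smat n q zero (suc (suc zero)) = 0ℚ
Smat n q (suc zero) zero = 1ℚ
Smat n q (suc zero) (suc zero) = ℕtoℚ (q ∸ 2)
Smat n q (suc zero) (suc (suc zero)) = ℕtoℚ ((n ∸ 1) ℕ.* (q ∸ 1))
Smat n q (suc (suc zero)) zero = 0ℚ
Smat n q (suc (suc zero)) (suc zero) = ℕtoℚ n
Smat n q (suc (suc zero)) (suc (suc zero)) = ℕtoℚ (n ℕ.* (q ∸ 2))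

FS : ∀ {n q} → Mat3 n q → Vertex n q → Fin 3 → ℚ
FS {n} {q} F x j = sumℚ (map (λ k → F x k * Smat n q k j) (allFin 3))

rowSum : ∀ {n q} → Mat3 n q → Vertex n q → ℚ
rowSum F x = sumℚ (map (F x) (allFin 3))

rowNonzeros : ∀ {n q} → Mat3 n q → Vertex n q → ℕ
rowNonzeros F x = length (filter (λ j → ¬? (F x j ≟ 0ℚ)) (allFin 3))

-- Write ‖T‖ₓ for n·w_T(x) = n|S₀(x) ∩ T| + n|S₁(x) ∩ T| + 2|S₂(x) ∩ T|, a natural number; (D3) says
-- ‖T₊‖ₓ = ‖T₋‖ₓ ≤ n for all x. The bound ‖T‖ₓ ≤ n excludes codewords at distance 1, 2 or 3 (they
-- overload it at one of them or at a neighbour of one), and conversely in a code of minimum distance 4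
-- the codewords near x can be charged to coordinates so that no coordinate is charged twice.
-- Counting common neighbours gives A² = n(q−1)I + (q−2)A + 2A₂. In AF = FS the first column forces the
-- second column of F to be Af and the zero row sums force the third to be −(f + Af); the remaining
-- equations then say n f + n Af + 2A₂f = 0, i.e. ‖T₊‖ₓ = ‖T₋‖ₓ. This F has a zero in every row, because a
-- codeword has no neighbour in its own code and at most one in the other.

module Submission where

open import Defs
open import Data.Nat using (ℕ; _≤_; NonZero)
open import Data.Fin using (Fin; zero)
open import Data.Product using (Σ; _×_)
open import Data.Rational using (ℚ; 1ℚ; 0ℚ) renaming (_≤_ to _≤ℚ_)
open import Relation.Binary.PropositionalEquality using (_≡_)
open import Function.Bundles using (_⇔_)

open import Data.Bool using (Bool; true; false; _∧_; not; if_then_else_)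
import Data.Bool.Properties as BoolP
open import Data.Empty using (⊥; ⊥-elim)
open import Data.Fin using (suc)
import Data.Fin.Properties as FinP
open import Data.Integer as ℤ using (+_)
import Data.Integer.Properties as ℤP
open import Data.List using (List; []; _∷_; map; concatMap; allFin; filterᵇ; length; _++_)
import Data.List.Properties as ListP
open import Data.List.Relation.Unary.Any using (Any; here; there)
open import Data.Nat as ℕ using (suc; _∸_; z≤n; s≤s)
import Data.Nat.Properties as ℕP
open import Data.Nat.Coprimality as Coprimality using (1-coprimeTo)
open import Data.Product using (_,_; proj₁; proj₂; Σ-syntax)
open import Data.Rational as ℚ using (mkℚ; _+_; _*_; -_; _-_; _/_; ↥_; toℚᵘ)
import Data.Rational.Properties as ℚP
open import Data.Rational.Solver using (module +-*-Solver)
import Data.Rational.Unnormalised as ℚᵘ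
import Data.Rational.Unnormalised.Properties as ℚᵘP
open import Data.Sum using (_⊎_; inj₁; inj₂)
open import Data.Vec using ([]; _∷_; lookup)
import Data.Vec.Properties as VecP
open import Function.Bundles using (mk⇔; Equivalence)
open import Relation.Binary.PropositionalEquality
  using (_≢_; refl; sym; trans; cong; cong₂; subst; subst₂; module ≡-Reasoning)
open import Relation.Nullary using (yes; no; ¬_; ¬?)
open import Relation.Nullary.Decidable using (⌊_⌋; fromWitness)

open import Algebra.Properties.CommutativeSemigroup ℕP.+-commutativeSemigroup
  using () renaming (interchange to +-interchange)
open import Algebra.Properties.Group ℚP.+-0-group
  using () renaming (x∙y⁻¹≈ε⇒x≈y to x-y≡0⇒x≡y)
open +-*-Solver using (solve; _:+_; _:*_; _:-_; :-_; _:=_; con)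

2ℚ : ℚ
2ℚ = ℕtoℚ 2

ℕtoℚ≡mkℚ : ∀ k → ℕtoℚ k ≡ mkℚ (+ k) 0 (Coprimality.sym (1-coprimeTo k))
ℕtoℚ≡mkℚ k = ℚP.↥p/↧p≡p _

toℚᵘ-ℕtoℚ : ∀ k → toℚᵘ (ℕtoℚ k) ≡ ℚᵘ.mkℚᵘ (+ k) 0
toℚᵘ-ℕtoℚ k rewrite ℕtoℚ≡mkℚ k = refl

ℕtoℚ-+ : ∀ a b → ℕtoℚ (a ℕ.+ b) ≡ ℕtoℚ a + ℕtoℚ b
ℕtoℚ-+ a b = ℚP.toℚᵘ-injective (begin
  toℚᵘ (ℕtoℚ (a ℕ.+ b))                  ≡⟨ toℚᵘ-ℕtoℚ (a ℕ.+ b) ⟩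
  ℚᵘ.mkℚᵘ (+ (a ℕ.+ b)) 0                 ≈⟨ ℚᵘ.*≡* cross ⟩
  ℚᵘ.mkℚᵘ (+ a) 0 ℚᵘ.+ ℚᵘ.mkℚᵘ (+ b) 0    ≡⟨ sym (cong₂ ℚᵘ._+_ (toℚᵘ-ℕtoℚ a) (toℚᵘ-ℕtoℚ b)) ⟩
  toℚᵘ (ℕtoℚ a) ℚᵘ.+ toℚᵘ (ℕtoℚ b)        ≈⟨ ℚᵘP.≃-sym (ℚP.toℚᵘ-homo-+ (ℕtoℚ a) (ℕtoℚ b)) ⟩
  toℚᵘ (ℕtoℚ a + ℕtoℚ b)                  ∎)
  where
  open ℚᵘP.≃-Reasoning
  cross : + (a ℕ.+ b) ℤ.* + 1 ≡ (+ a ℤ.* + 1 ℤ.+ + b ℤ.* + 1) ℤ.* + 1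
  cross = cong (ℤ._* + 1) (trans (ℤP.pos-+ a b)
            (sym (cong₂ ℤ._+_ (ℤP.*-identityʳ (+ a)) (ℤP.*-identityʳ (+ b)))))

ℕtoℚ-* : ∀ a b → ℕtoℚ (a ℕ.* b) ≡ ℕtoℚ a * ℕtoℚ b
ℕtoℚ-* a b = ℚP.toℚᵘ-injective (begin
  toℚᵘ (ℕtoℚ (a ℕ.* b))                  ≡⟨ toℚᵘ-ℕtoℚ (a ℕ.* b) ⟩
  ℚᵘ.mkℚᵘ (+ (a ℕ.* b)) 0                 ≈⟨ ℚᵘ.*≡* (cong (ℤ._* + 1) (ℤP.pos-* a b)) ⟩
  ℚᵘ.mkℚᵘ (+ a) 0 ℚᵘ.* ℚᵘ.mkℚᵘ (+ b) 0    ≡⟨ sym (cong₂ ℚᵘ._*_ (toℚᵘ-ℕtoℚ a) (toℚᵘ-ℕtoℚ b)) ⟩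
  toℚᵘ (ℕtoℚ a) ℚᵘ.* toℚᵘ (ℕtoℚ b)        ≈⟨ ℚᵘP.≃-sym (ℚP.toℚᵘ-homo-* (ℕtoℚ a) (ℕtoℚ b)) ⟩
  toℚᵘ (ℕtoℚ a * ℕtoℚ b)                  ∎)
  where open ℚᵘP.≃-Reasoning

ℕtoℚ-∸ : ∀ a b → b ≤ a → ℕtoℚ (a ∸ b) ≡ ℕtoℚ a - ℕtoℚ b
ℕtoℚ-∸ a b b≤a = begin
  ℕtoℚ (a ∸ b)                     ≡⟨ solve 2 (λ d b → d := (d :+ b) :- b) refl (ℕtoℚ (a ∸ b)) (ℕtoℚ b) ⟩
  (ℕtoℚ (a ∸ b) + ℕtoℚ b) - ℕtoℚ b ≡⟨ cong (_- ℕtoℚ b) (sym (ℕtoℚ-+ (a ∸ b) b)) ⟩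
  ℕtoℚ (a ∸ b ℕ.+ b) - ℕtoℚ b       ≡⟨ cong (λ t → ℕtoℚ t - ℕtoℚ b) (ℕP.m∸n+n≡m b≤a) ⟩
  ℕtoℚ a - ℕtoℚ b                  ∎
  where open ≡-Reasoning

ℕtoℚ-injective : ∀ {a b} → ℕtoℚ a ≡ ℕtoℚ b → a ≡ b
ℕtoℚ-injective {a} {b} eq = ℤP.+-injective (trans (sym (↥-ℕtoℚ a)) (trans (cong ↥_ eq) (↥-ℕtoℚ b)))
  where
  ↥-ℕtoℚ : ∀ k → ↥ (ℕtoℚ k) ≡ + k
  ↥-ℕtoℚ k rewrite ℕtoℚ≡mkℚ k = refl

ℕtoℚ-mono-≤ : ∀ {a b} → a ≤ b → ℕtoℚ a ≤ℚ ℕtoℚ b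
ℕtoℚ-mono-≤ {a} {b} a≤b rewrite ℕtoℚ≡mkℚ a | ℕtoℚ≡mkℚ b =
  ℚ.*≤* (subst₂ ℤ._≤_ (sym (ℤP.*-identityʳ (+ a))) (sym (ℤP.*-identityʳ (+ b))) (ℤ.+≤+ a≤b))

ℕtoℚ-cancel-≤ : ∀ {a b} → ℕtoℚ a ≤ℚ ℕtoℚ b → a ≤ b
ℕtoℚ-cancel-≤ {a} {b} le rewrite ℕtoℚ≡mkℚ a | ℕtoℚ≡mkℚ b =
  ℤP.drop‿+≤+ (subst₂ ℤ._≤_ (ℤP.*-identityʳ (+ a)) (ℤP.*-identityʳ (+ b)) (ℚP.drop-*≤* le))

ℕtoℚ-nonNegative : ∀ k → ℚ.NonNegative (ℕtoℚ k)
ℕtoℚ-nonNegative k rewrite ℕtoℚ≡mkℚ k = _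

ℕtoℚ-suc-positive : ∀ m → ℚ.Positive (ℕtoℚ (suc m))
ℕtoℚ-suc-positive m rewrite ℕtoℚ≡mkℚ (suc m) = _

n*[k/n]≡k : ∀ m k → ℕtoℚ (suc m) * (+ k / suc m) ≡ ℕtoℚ k
n*[k/n]≡k m k = ℚP.toℚᵘ-injective (begin
  toℚᵘ (ℕtoℚ (suc m) * (+ k / suc m))          ≈⟨ ℚP.toℚᵘ-homo-* (ℕtoℚ (suc m)) (+ k / suc m) ⟩
  toℚᵘ (ℕtoℚ (suc m)) ℚᵘ.* toℚᵘ (+ k / suc m)  ≈⟨ ℚᵘP.*-cong (ℚᵘP.≃-reflexive (toℚᵘ-ℕtoℚ (suc m)))
                                                              (ℚP.toℚᵘ-fromℚᵘ (ℚᵘ.mkℚᵘ (+ k) m)) ⟩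
  ℚᵘ.mkℚᵘ (+ suc m) 0 ℚᵘ.* ℚᵘ.mkℚᵘ (+ k) m     ≈⟨ ℚᵘ.*≡* cross ⟩
  ℚᵘ.mkℚᵘ (+ k) 0                              ≡⟨ sym (toℚᵘ-ℕtoℚ k) ⟩
  toℚᵘ (ℕtoℚ k)                                ∎)
  where
  open ℚᵘP.≃-Reasoning
  cross : (+ suc m ℤ.* + k) ℤ.* + 1 ≡ + k ℤ.* + (1 ℕ.* suc m)
  cross rewrite ℕP.*-identityˡ (suc m) = trans (ℤP.*-identityʳ _) (ℤP.*-comm (+ suc m) (+ k))

ℕtoℚ-suc-*-cancelˡ : ∀ m {p r} → ℕtoℚ (suc m) * p ≡ ℕtoℚ (suc m) * r → p ≡ r
ℕtoℚ-suc-*-cancelˡ m {p} {r} eq = ℚP.≤-antisym (cancel (ℚP.≤-reflexive eq)) (cancel (ℚP.≤-reflexive (sym eq)))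
  where
  cancel : ∀ {u v} → ℕtoℚ (suc m) * u ≤ℚ ℕtoℚ (suc m) * v → u ≤ℚ v
  cancel = ℚP.*-cancelˡ-≤-pos (ℕtoℚ (suc m)) {{ℕtoℚ-suc-positive m}}

∑ : {A : Set} → List A → (A → ℚ) → ℚ
∑ l g = sumℚ (map g l)

when : Bool → ℚ → ℚ
when b v = if b then v else 0ℚ

when-∧ : ∀ a b v → when (a ∧ b) v ≡ when a (when b v)
when-∧ true  b v = refl
when-∧ false b v = refl

0≤1 : 0ℚ ≤ℚ 1ℚ
0≤1 = ℚ.*≤* (ℤ.+≤+ z≤n)

𝟙 : Bool → ℚ
𝟙 b = when b 1ℚ

when-*ʳ : ∀ b v → when b v ≡ 𝟙 b * v
when-*ʳ true  v = sym (ℚP.*-identityˡ v)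
when-*ʳ false v = sym (ℚP.*-zeroˡ v)

𝟙-∧ : ∀ a b → 𝟙 (a ∧ b) ≡ 𝟙 a * 𝟙 b
𝟙-∧ true  b = sym (ℚP.*-identityˡ (𝟙 b))
𝟙-∧ false b = sym (ℚP.*-zeroˡ (𝟙 b))

𝟙-mono-≤ : ∀ {a b} → (a ≡ true → b ≡ true) → 𝟙 a ≤ℚ 𝟙 b
𝟙-mono-≤ {true}  a⇒b rewrite a⇒b refl = ℚP.≤-refl
𝟙-mono-≤ {false} {true}  _ = 0≤1
𝟙-mono-≤ {false} {false} _ = ℚP.≤-refl

module _ {A : Set} where

  ∑-filterᵇ : (P : A → Bool) (g : A → ℚ) (l : List A) → ∑ (filterᵇ P l) g ≡ ∑ l (λ y → when (P y) (g y))
  ∑-filterᵇ P g [] = refl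
  ∑-filterᵇ P g (y ∷ l) with P y
  ... | true  = cong (_+_ (g y)) (∑-filterᵇ P g l)
  ... | false = trans (∑-filterᵇ P g l) (sym (ℚP.+-identityˡ _))

  ∑-cong : (l : List A) {g h : A → ℚ} → (∀ y → g y ≡ h y) → ∑ l g ≡ ∑ l h
  ∑-cong []      eq = refl
  ∑-cong (y ∷ l) eq = cong₂ _+_ (eq y) (∑-cong l eq)

  ∑-zero : (l : List A) → ∑ l (λ _ → 0ℚ) ≡ 0ℚ
  ∑-zero []      = refl
  ∑-zero (y ∷ l) = trans (ℚP.+-identityˡ _) (∑-zero l)

  ∑-+ : (l : List A) (g h : A → ℚ) → ∑ l (λ y → g y + h y) ≡ ∑ l g + ∑ l h
  ∑-+ []      g h = refl
  ∑-+ (y ∷ l) g h rewrite ∑-+ l g h =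
    solve 4 (λ a b c d → (a :+ b) :+ (c :+ d) := (a :+ c) :+ (b :+ d)) refl (g y) (h y) (∑ l g) (∑ l h)

  ∑-*ˡ : (l : List A) (c : ℚ) (g : A → ℚ) → ∑ l (λ y → c * g y) ≡ c * ∑ l g
  ∑-*ˡ []      c g = sym (ℚP.*-zeroʳ c)
  ∑-*ˡ (y ∷ l) c g rewrite ∑-*ˡ l c g = sym (ℚP.*-distribˡ-+ c (g y) (∑ l g))

  ∑-*ʳ : (l : List A) (c : ℚ) (g : A → ℚ) → ∑ l (λ y → g y * c) ≡ ∑ l g * c
  ∑-*ʳ []      c g = sym (ℚP.*-zeroˡ c)
  ∑-*ʳ (y ∷ l) c g rewrite ∑-*ʳ l c g = sym (ℚP.*-distribʳ-+ c (g y) (∑ l g))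

  ∑-neg : (l : List A) (g : A → ℚ) → ∑ l (λ y → - g y) ≡ - ∑ l g
  ∑-neg []      g = refl
  ∑-neg (y ∷ l) g rewrite ∑-neg l g = sym (ℚP.neg-distrib-+ (g y) (∑ l g))

  ∑-const : (l : List A) (c : ℚ) → ∑ l (λ _ → c) ≡ ℕtoℚ (length l) * c
  ∑-const []      c = sym (ℚP.*-zeroˡ c)
  ∑-const (y ∷ l) c rewrite ∑-const l c | ℕtoℚ-+ 1 (length l) =
    solve 2 (λ c k → c :+ k :* c := (con 1ℚ :+ k) :* c) refl c (ℕtoℚ (length l))

  when-∑ : (b : Bool) (l : List A) (h : A → ℚ) → when b (∑ l h) ≡ ∑ l (λ y → when b (h y))
  when-∑ true  l h = refl
  when-∑ false l h = sym (∑-zero l)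

  ℕtoℚ-length-filterᵇ : (P : A → Bool) (l : List A) → ℕtoℚ (length (filterᵇ P l)) ≡ ∑ l (λ y → 𝟙 (P y))
  ℕtoℚ-length-filterᵇ P []      = refl
  ℕtoℚ-length-filterᵇ P (y ∷ l) with P y
  ... | true  = trans (ℕtoℚ-+ 1 (length (filterᵇ P l))) (cong (_+_ 1ℚ) (ℕtoℚ-length-filterᵇ P l))
  ... | false = trans (ℕtoℚ-length-filterᵇ P l) (sym (ℚP.+-identityˡ _))

  ∑-++ : (l l′ : List A) (g : A → ℚ) → ∑ (l ++ l′) g ≡ ∑ l g + ∑ l′ g
  ∑-++ []      l′ g = sym (ℚP.+-identityˡ _)
  ∑-++ (y ∷ l) l′ g rewrite ∑-++ l l′ g = sym (ℚP.+-assoc (g y) (∑ l g) (∑ l′ g))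

  ∑-mono-≤ : (l : List A) {g h : A → ℚ} → (∀ y → g y ≤ℚ h y) → ∑ l g ≤ℚ ∑ l h
  ∑-mono-≤ []      le = ℚP.≤-refl
  ∑-mono-≤ (y ∷ l) le = ℚP.+-mono-≤ (le y) (∑-mono-≤ l le)

  filterᵇ-head : (P : A → Bool) (l : List A) {z : A} {r : List A} → filterᵇ P l ≡ z ∷ r → P z ≡ true
  filterᵇ-head P (y ∷ l) eq with P y in Py
  ... | true  = subst (λ t → P t ≡ true) (proj₁ (ListP.∷-injective eq)) Py
  ... | false = filterᵇ-head P l eq

module _ {A B : Set} where

  ∑-map : (f : A → B) (l : List A) (g : B → ℚ) → ∑ (map f l) g ≡ ∑ l (λ a → g (f a))
  ∑-map f []      g = refl
  ∑-map f (y ∷ l) g = cong (_+_ (g (f y))) (∑-map f l g)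

  ∑-concatMap : (f : A → List B) (l : List A) (g : B → ℚ) → ∑ (concatMap f l) g ≡ ∑ l (λ a → ∑ (f a) g)
  ∑-concatMap f []      g = refl
  ∑-concatMap f (y ∷ l) g = trans (∑-++ (f y) (concatMap f l) g) (cong (_+_ (∑ (f y) g)) (∑-concatMap f l g))

  ∑-swap : (l : List A) (l′ : List B) (h : A → B → ℚ) →
           ∑ l (λ y → ∑ l′ (λ z → h y z)) ≡ ∑ l′ (λ z → ∑ l (λ y → h y z))
  ∑-swap []      l′ h = sym (∑-zero l′)
  ∑-swap (y ∷ l) l′ h rewrite ∑-swap l l′ h = sym (∑-+ l′ (h y) (λ z → ∑ l (λ y → h y z)))

∑-allFin-suc : ∀ q (g : Fin (suc q) → ℚ) → ∑ (allFin (suc q)) g ≡ g zero + ∑ (allFin q) (λ b → g (suc b))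
∑-allFin-suc q g = cong (_+_ (g zero))
  (trans (cong (λ l → ∑ l g) (sym (ListP.map-tabulate (λ b → b) suc))) (∑-map suc (allFin q) g))

∑-allFin-const : ∀ q c → ∑ (allFin q) (λ _ → c) ≡ ℕtoℚ q * c
∑-allFin-const q c = trans (∑-const (allFin q) c) (cong (λ k → ℕtoℚ k * c) (ListP.length-tabulate {n = q} (λ b → b)))

module _ {q : ℕ} where

  ⌊≟⌋-refl : (a : Fin q) → ⌊ a FinP.≟ a ⌋ ≡ true
  ⌊≟⌋-refl a with a FinP.≟ a
  ... | yes _  = refl
  ... | no a≢a = ⊥-elim (a≢a refl)

  ⌊≟⌋-≢ : {a b : Fin q} → a ≢ b → ⌊ a FinP.≟ b ⌋ ≡ false
  ⌊≟⌋-≢ {a} {b} a≢b with a FinP.≟ b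
  ... | yes a≡b = ⊥-elim (a≢b a≡b)
  ... | no _    = refl

  ⌊≟⌋-sym : (a b : Fin q) → ⌊ a FinP.≟ b ⌋ ≡ ⌊ b FinP.≟ a ⌋
  ⌊≟⌋-sym a b with a FinP.≟ b
  ... | yes refl = sym (⌊≟⌋-refl a)
  ... | no a≢b   = sym (⌊≟⌋-≢ (λ b≡a → a≢b (sym b≡a)))

  ⌊suc≟suc⌋ : (a b : Fin q) → ⌊ suc a FinP.≟ suc b ⌋ ≡ ⌊ a FinP.≟ b ⌋
  ⌊suc≟suc⌋ a b with a FinP.≟ b
  ... | yes refl = refl
  ... | no _     = refl

∑-allFin-δ : ∀ q (a : Fin q) (g : Fin q → ℚ) → ∑ (allFin q) (λ b → when ⌊ a FinP.≟ b ⌋ (g b)) ≡ g a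
∑-allFin-δ (suc q) zero g =
  trans (∑-allFin-suc q (λ b → when ⌊ zero FinP.≟ b ⌋ (g b)))
        (trans (cong (_+_ (g zero)) (∑-zero (allFin q))) (ℚP.+-identityʳ (g zero)))
∑-allFin-δ (suc q) (suc a) g =
  trans (∑-allFin-suc q (λ b → when ⌊ suc a FinP.≟ b ⌋ (g b))) (trans (ℚP.+-identityˡ _)
    (trans (∑-cong (allFin q) (λ b → cong (λ t → when t (g (suc b))) (⌊suc≟suc⌋ a b))) (∑-allFin-δ q a (λ b → g (suc b)))))

∑-allFin-point : ∀ q (a : Fin q) u v → ∑ (allFin q) (λ b → when ⌊ a FinP.≟ b ⌋ u + v) ≡ u + ℕtoℚ q * v
∑-allFin-point q a u v = trans (∑-+ (allFin q) _ _) (cong₂ _+_ (∑-allFin-δ q a (λ _ → u)) (∑-allFin-const q v))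

-- Hamming distance

sphereᵇ : ∀ {n q} → ℕ → Vertex n q → Vertex n q → Bool
sphereᵇ i x y = ⌊ dist x y ℕP.≟ i ⌋

⌊1+d≟1⌋ : ∀ d → ⌊ suc d ℕP.≟ 1 ⌋ ≡ ⌊ d ℕP.≟ 0 ⌋
⌊1+d≟1⌋ 0       = refl
⌊1+d≟1⌋ (suc d) = refl

dist-refl : ∀ {n q} (x : Vertex n q) → dist x x ≡ 0
dist-refl []      = refl
dist-refl (a ∷ x) rewrite ⌊≟⌋-refl a = dist-refl x

dist-∷-≡ : ∀ {n q} (a : Fin q) (x y : Vertex n q) → dist (a ∷ x) (a ∷ y) ≡ dist x y
dist-∷-≡ a x y rewrite ⌊≟⌋-refl a = refl

dist-∷-≢ : ∀ {n q} {a b : Fin q} (x y : Vertex n q) → a ≢ b → dist (a ∷ x) (b ∷ y) ≡ suc (dist x y)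
dist-∷-≢ x y a≢b rewrite ⌊≟⌋-≢ a≢b = refl

dist-sym : ∀ {n q} (x y : Vertex n q) → dist x y ≡ dist y x
dist-sym []      []      = refl
dist-sym (a ∷ x) (b ∷ y) rewrite ⌊≟⌋-sym a b | dist-sym x y = refl

dist≡0⇒≡ : ∀ {n q} (x y : Vertex n q) → dist x y ≡ 0 → x ≡ y
dist≡0⇒≡ []      []      _  = refl
dist≡0⇒≡ (a ∷ x) (b ∷ y) eq with a FinP.≟ b
... | yes refl = cong (a ∷_) (dist≡0⇒≡ x y eq)
... | no _     = ⊥-elim (ℕP.1+n≢0 eq)

sphereᵇ-0⇒≡ : ∀ {n q} (x y : Vertex n q) → sphereᵇ 0 x y ≡ true → x ≡ y
sphereᵇ-0⇒≡ x y s = dist≡0⇒≡ x y (≟0 (dist x y) s)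
  where
  ≟0 : ∀ d → ⌊ d ℕP.≟ 0 ⌋ ≡ true → d ≡ 0
  ≟0 0 _ = refl

sphereᵇ-intro : ∀ {n q} {i} (x y : Vertex n q) → dist x y ≡ i → sphereᵇ i x y ≡ true
sphereᵇ-intro {i = i} x y d = Equivalence.to BoolP.T-≡ (fromWitness {a? = dist x y ℕP.≟ i} d)

sphereᵇ-sym : ∀ {n q} i (x y : Vertex n q) → sphereᵇ i x y ≡ sphereᵇ i y x
sphereᵇ-sym i x y = cong (λ d → ⌊ d ℕP.≟ i ⌋) (dist-sym x y)

mismatch : ∀ {q} → Fin q → Fin q → ℕ
mismatch a b = if ⌊ a FinP.≟ b ⌋ then 0 else 1

mismatch≤1 : ∀ {q} (a b : Fin q) → mismatch a b ≤ 1
mismatch≤1 a b with ⌊ a FinP.≟ b ⌋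
... | true  = z≤n
... | false = s≤s z≤n

mismatch-triangle : ∀ {q} (a b c : Fin q) → mismatch a c ≤ mismatch a b ℕ.+ mismatch b c
mismatch-triangle a b c with a FinP.≟ b | b FinP.≟ c
... | yes refl | yes refl rewrite ⌊≟⌋-refl a = z≤n
... | yes refl | no _     = mismatch≤1 a c
... | no _     | _        = ℕP.≤-trans (mismatch≤1 a c) (ℕP.m≤m+n 1 _)

dist-triangle : ∀ {n q} (x y z : Vertex n q) → dist x z ≤ dist x y ℕ.+ dist y z
dist-triangle []      []      []      = z≤n
dist-triangle (a ∷ x) (b ∷ y) (c ∷ z) =
  ℕP.≤-trans (ℕP.+-mono-≤ (mismatch-triangle a b c) (dist-triangle x y z))
             (ℕP.≤-reflexive (+-interchange (mismatch a b) (mismatch b c) (dist x y) (dist y z)))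

-- Coordinate i contributes 2 to the right-hand side but at most 1 to dist z z′.
dist-triangle-sharedMismatch : ∀ {n q} (x z z′ : Vertex n q) (i : Fin n) →
  lookup x i ≢ lookup z i → lookup x i ≢ lookup z′ i → suc (dist z z′) ≤ dist z x ℕ.+ dist x z′
dist-triangle-sharedMismatch (a ∷ x) (c ∷ z) (c′ ∷ z′) zero a≢c a≢c′
  rewrite ⌊≟⌋-≢ (λ c≡a → a≢c (sym c≡a)) | ⌊≟⌋-≢ a≢c′ =
  s≤s (ℕP.≤-trans (ℕP.+-mono-≤ (mismatch≤1 c c′) (dist-triangle z x z′))
                  (ℕP.≤-reflexive (sym (ℕP.+-suc (dist z x) (dist x z′)))))
dist-triangle-sharedMismatch (a ∷ x) (c ∷ z) (c′ ∷ z′) (suc i) a≢c a≢c′ =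
  ℕP.≤-trans (ℕP.≤-reflexive (sym (ℕP.+-suc (mismatch c c′) (dist z z′))))
    (ℕP.≤-trans (ℕP.+-mono-≤ (mismatch-triangle c a c′) (dist-triangle-sharedMismatch x z z′ i a≢c a≢c′))
                (ℕP.≤-reflexive (+-interchange (mismatch c a) (mismatch a c′) (dist z x) (dist x z′))))

midpoint : ∀ {n q} (x y : Vertex n q) k → dist x y ≡ suc k → Σ[ z ∈ Vertex n q ] (dist x z ≡ 1 × dist z y ≡ k)
midpoint []      []      k ()
midpoint (a ∷ x) (b ∷ y) k eq with a FinP.≟ b
... | yes refl with midpoint x y k eq
...   | z , d₁ , d₂ = a ∷ z , trans (dist-∷-≡ a x z) d₁ , trans (dist-∷-≡ a z y) d₂
midpoint (a ∷ x) (b ∷ y) k eq | no a≢b =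
  b ∷ x , trans (dist-∷-≢ x x a≢b) (cong suc (dist-refl x)) , trans (dist-∷-≡ b x y) (ℕP.suc-injective eq)

differsAt : ∀ {n q} → Vertex n q → Vertex n q → Fin n → Bool
differsAt x z i = not ⌊ lookup x i FinP.≟ lookup z i ⌋

differsAt⇒≢ : ∀ {n q} (x z : Vertex n q) i → differsAt x z i ≡ true → lookup x i ≢ lookup z i
differsAt⇒≢ x z i d with lookup x i FinP.≟ lookup z i
differsAt⇒≢ x z i () | yes _
... | no xᵢ≢zᵢ = xᵢ≢zᵢ

ℕtoℚ-dist : ∀ {n q} (x z : Vertex n q) → ℕtoℚ (dist x z) ≡ ∑ (allFin n) (λ i → 𝟙 (differsAt x z i))
ℕtoℚ-dist []      []      = refl
ℕtoℚ-dist {suc n} (a ∷ x) (c ∷ z) =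
  trans (ℕtoℚ-+ (mismatch a c) (dist x z))
        (trans (cong₂ _+_ (head ⌊ a FinP.≟ c ⌋) (ℕtoℚ-dist x z))
               (sym (∑-allFin-suc n (λ i → 𝟙 (differsAt (a ∷ x) (c ∷ z) i)))))
  where
  head : ∀ b → ℕtoℚ (if b then 0 else 1) ≡ 𝟙 (not b)
  head true  = refl
  head false = refl

∑-allV-suc : ∀ n q (h : Vertex (suc n) q → ℚ) →
             ∑ (allV (suc n) q) h ≡ ∑ (allFin q) (λ b → ∑ (allV n q) (λ y → h (b ∷ y)))
∑-allV-suc n q h = trans (∑-concatMap _ (allFin q) h) (∑-cong (allFin q) (λ b → ∑-map (b ∷_) (allV n q) h))

∑-allV-δ : ∀ {n q} (x : Vertex n q) (g : Vertex n q → ℚ) → ∑ (allV n q) (λ y → when (sphereᵇ 0 x y) (g y)) ≡ g x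
∑-allV-δ {0}     {q} [] g = ℚP.+-identityʳ (g [])
∑-allV-δ {suc n} {q} (a ∷ x) g =
  trans (∑-allV-suc n q _) (trans (∑-cong (allFin q) byHead) (∑-allFin-δ q a (λ b → g (b ∷ x))))
  where
  byHead : ∀ b → ∑ (allV n q) (λ y → when (sphereᵇ 0 (a ∷ x) (b ∷ y)) (g (b ∷ y))) ≡ when ⌊ a FinP.≟ b ⌋ (g (b ∷ x))
  byHead b with a FinP.≟ b
  ... | yes refl = ∑-allV-δ x (λ y → g (a ∷ y))
  ... | no _     = ∑-zero (allV n q)

∑-𝟙-atMostOne : ∀ {n q} (Q : Vertex n q → Bool) → (∀ z z′ → Q z ≡ true → Q z′ ≡ true → z ≡ z′) →
                ∑ (allV n q) (λ y → 𝟙 (Q y)) ≤ℚ 1ℚ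
∑-𝟙-atMostOne {n} {q} Q unique with filterᵇ Q (allV n q) in eq
... | [] = begin
  ∑ (allV n q) (λ y → 𝟙 (Q y))            ≡⟨ sym (ℕtoℚ-length-filterᵇ Q (allV n q)) ⟩
  ℕtoℚ (length (filterᵇ Q (allV n q)))    ≡⟨ cong (λ l → ℕtoℚ (length l)) eq ⟩
  0ℚ                                      ≤⟨ 0≤1 ⟩
  1ℚ                                      ∎
  where open ℚP.≤-Reasoning
... | z ∷ _ = begin
  ∑ (allV n q) (λ y → 𝟙 (Q y))            ≤⟨ ∑-mono-≤ (allV n q) (λ y → 𝟙-mono-≤ (y≡z y)) ⟩
  ∑ (allV n q) (λ y → 𝟙 (sphereᵇ 0 z y))  ≡⟨ ∑-allV-δ z (λ _ → 1ℚ) ⟩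
  1ℚ                                      ∎
  where
  open ℚP.≤-Reasoning
  y≡z : ∀ y → Q y ≡ true → sphereᵇ 0 z y ≡ true
  y≡z y Qy = sphereᵇ-intro z y (subst (λ t → dist z t ≡ 0) (unique z y (filterᵇ-head Q (allV n q) eq) Qy) (dist-refl z))

-- Common neighbours and the square of the adjacency matrix

-- Intersection numbers p¹¹_D of H(n,q): the number of common neighbours of two vertices at distance D.
p₁₁ : ℕ → ℕ → ℕ → ℚ
p₁₁ q n 0                   = ℕtoℚ n * (ℕtoℚ q - 1ℚ)
p₁₁ q n 1                   = ℕtoℚ q - 2ℚ
p₁₁ q n 2                   = 2ℚ
p₁₁ q n (suc (suc (suc _))) = 0ℚ

p₁₁-suc-sameHead : ∀ q n D → p₁₁ q n D + (ℕtoℚ q - 1ℚ) * 𝟙 ⌊ D ℕP.≟ 0 ⌋ ≡ p₁₁ q (suc n) D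
p₁₁-suc-sameHead q n 0 rewrite ℕtoℚ-+ 1 n =
  solve 2 (λ N Q → N :* (Q :- con 1ℚ) :+ (Q :- con 1ℚ) :* con 1ℚ := (con 1ℚ :+ N) :* (Q :- con 1ℚ)) refl (ℕtoℚ n) (ℕtoℚ q)
p₁₁-suc-sameHead q n 1 = solve 1 (λ Q → (Q :- con 2ℚ) :+ (Q :- con 1ℚ) :* con 0ℚ := Q :- con 2ℚ) refl (ℕtoℚ q)
p₁₁-suc-sameHead q n 2 = solve 1 (λ Q → con 2ℚ :+ (Q :- con 1ℚ) :* con 0ℚ := con 2ℚ) refl (ℕtoℚ q)
p₁₁-suc-sameHead q n (suc (suc (suc D))) = solve 1 (λ Q → con 0ℚ :+ (Q :- con 1ℚ) :* con 0ℚ := con 0ℚ) refl (ℕtoℚ q)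

p₁₁-suc-differentHead : ∀ q n D → 2ℚ * 𝟙 ⌊ D ℕP.≟ 1 ⌋ + (ℕtoℚ q - 2ℚ) * 𝟙 ⌊ D ℕP.≟ 0 ⌋ ≡ p₁₁ q (suc n) (suc D)
p₁₁-suc-differentHead q n 0 = solve 1 (λ Q → con 2ℚ :* con 0ℚ :+ (Q :- con 2ℚ) :* con 1ℚ := Q :- con 2ℚ) refl (ℕtoℚ q)
p₁₁-suc-differentHead q n 1 = solve 1 (λ Q → con 2ℚ :* con 1ℚ :+ (Q :- con 2ℚ) :* con 0ℚ := con 2ℚ) refl (ℕtoℚ q)
p₁₁-suc-differentHead q n (suc (suc D)) = solve 1 (λ Q → con 2ℚ :* con 0ℚ :+ (Q :- con 2ℚ) :* con 0ℚ := con 0ℚ) refl (ℕtoℚ q)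

commonNeighbours : ∀ {n q} → Vertex n q → Vertex n q → ℚ
commonNeighbours {n} {q} x z = ∑ (allV n q) (λ y → 𝟙 (sphereᵇ 1 x y ∧ sphereᵇ 1 y z))

-- Number of common neighbours b ∷ y of a ∷ x and c ∷ z with a given first coordinate b, in terms of
-- N = commonNeighbours x z and the indicators δ₁, δ₀ of d(x,z) = 1 and d(x,z) = 0.
headContribution : ∀ {q} (a c : Fin q) (N δ₁ δ₀ : ℚ) → Fin q → ℚ
headContribution a c N δ₁ δ₀ b =
  if ⌊ a FinP.≟ b ⌋ then (if ⌊ b FinP.≟ c ⌋ then N else δ₁) else (if ⌊ b FinP.≟ c ⌋ then δ₁ else δ₀)

∑-headContribution-same : ∀ q (a : Fin q) N δ₁ δ₀ → ∑ (allFin q) (headContribution a a N δ₁ δ₀) ≡ N + (ℕtoℚ q - 1ℚ) * δ₀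
∑-headContribution-same q a N δ₁ δ₀ = begin
  ∑ (allFin q) (headContribution a a N δ₁ δ₀)            ≡⟨ ∑-cong (allFin q) pointwise ⟩
  ∑ (allFin q) (λ b → when ⌊ a FinP.≟ b ⌋ (N - δ₀) + δ₀) ≡⟨ ∑-allFin-point q a (N - δ₀) δ₀ ⟩
  (N - δ₀) + ℕtoℚ q * δ₀
    ≡⟨ solve 3 (λ N d Q → (N :- d) :+ Q :* d := N :+ (Q :- con 1ℚ) :* d) refl N δ₀ (ℕtoℚ q) ⟩
  N + (ℕtoℚ q - 1ℚ) * δ₀                                ∎
  where
  open ≡-Reasoning
  pointwise : ∀ b → headContribution a a N δ₁ δ₀ b ≡ when ⌊ a FinP.≟ b ⌋ (N - δ₀) + δ₀
  pointwise b rewrite ⌊≟⌋-sym b a with a FinP.≟ b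
  ... | yes refl = solve 2 (λ N d → N := (N :- d) :+ d) refl N δ₀
  ... | no _     = sym (ℚP.+-identityˡ δ₀)

∑-headContribution-different : ∀ q {a c : Fin q} → a ≢ c → ∀ N δ₁ δ₀ →
  ∑ (allFin q) (headContribution a c N δ₁ δ₀) ≡ 2ℚ * δ₁ + (ℕtoℚ q - 2ℚ) * δ₀
∑-headContribution-different q {a} {c} a≢c N δ₁ δ₀ = begin
  ∑ (allFin q) (headContribution a c N δ₁ δ₀)
    ≡⟨ ∑-cong (allFin q) pointwise ⟩
  ∑ (allFin q) (λ b → when ⌊ a FinP.≟ b ⌋ (δ₁ - δ₀) + (when ⌊ c FinP.≟ b ⌋ (δ₁ - δ₀) + δ₀))
    ≡⟨ ∑-+ (allFin q) _ _ ⟩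
  ∑ (allFin q) (λ b → when ⌊ a FinP.≟ b ⌋ (δ₁ - δ₀)) + ∑ (allFin q) (λ b → when ⌊ c FinP.≟ b ⌋ (δ₁ - δ₀) + δ₀)
    ≡⟨ cong₂ _+_ (∑-allFin-δ q a (λ _ → δ₁ - δ₀)) (∑-allFin-point q c (δ₁ - δ₀) δ₀) ⟩
  (δ₁ - δ₀) + ((δ₁ - δ₀) + ℕtoℚ q * δ₀)
    ≡⟨ solve 3 (λ e₁ e₀ Q → (e₁ :- e₀) :+ ((e₁ :- e₀) :+ Q :* e₀) := con 2ℚ :* e₁ :+ (Q :- con 2ℚ) :* e₀)
               refl δ₁ δ₀ (ℕtoℚ q) ⟩
  2ℚ * δ₁ + (ℕtoℚ q - 2ℚ) * δ₀ ∎
  where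
  open ≡-Reasoning
  pointwise : ∀ b → headContribution a c N δ₁ δ₀ b ≡ when ⌊ a FinP.≟ b ⌋ (δ₁ - δ₀) + (when ⌊ c FinP.≟ b ⌋ (δ₁ - δ₀) + δ₀)
  pointwise b rewrite ⌊≟⌋-sym b c with a FinP.≟ b | c FinP.≟ b
  ... | yes refl | yes refl = ⊥-elim (a≢c refl)
  ... | yes refl | no _     = solve 2 (λ e₁ e₀ → e₁ := (e₁ :- e₀) :+ (con 0ℚ :+ e₀)) refl δ₁ δ₀
  ... | no _     | yes refl = solve 2 (λ e₁ e₀ → e₁ := con 0ℚ :+ ((e₁ :- e₀) :+ e₀)) refl δ₁ δ₀
  ... | no _     | no _     = solve 1 (λ e₀ → e₀ := con 0ℚ :+ (con 0ℚ :+ e₀)) refl δ₀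

commonNeighbours-∷ : ∀ {n q} (a c : Fin q) (x z : Vertex n q) → commonNeighbours (a ∷ x) (c ∷ z) ≡
  ∑ (allFin q) (headContribution a c (commonNeighbours x z) (𝟙 (sphereᵇ 1 x z)) (𝟙 (sphereᵇ 0 x z)))
commonNeighbours-∷ {n} {q} a c x z = trans (∑-allV-suc n q _) (∑-cong (allFin q) byHead)
  where
  byHead : ∀ b → ∑ (allV n q) (λ y → 𝟙 (sphereᵇ 1 (a ∷ x) (b ∷ y) ∧ sphereᵇ 1 (b ∷ y) (c ∷ z))) ≡
                 headContribution a c (commonNeighbours x z) (𝟙 (sphereᵇ 1 x z)) (𝟙 (sphereᵇ 0 x z)) b
  byHead b with a FinP.≟ b | b FinP.≟ c
  ... | yes refl | yes refl = refl
  ... | yes refl | no _     = trans (∑-cong (allV n q) reorder) (∑-allV-δ z (λ y → 𝟙 (sphereᵇ 1 x y)))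
    where
    reorder : ∀ y → 𝟙 (sphereᵇ 1 x y ∧ ⌊ suc (dist y z) ℕP.≟ 1 ⌋) ≡ when (sphereᵇ 0 z y) (𝟙 (sphereᵇ 1 x y))
    reorder y = trans (cong 𝟙 (trans (cong (sphereᵇ 1 x y ∧_) (trans (⌊1+d≟1⌋ (dist y z)) (sphereᵇ-sym 0 y z)))
                                     (BoolP.∧-comm (sphereᵇ 1 x y) (sphereᵇ 0 z y))))
                      (when-∧ (sphereᵇ 0 z y) (sphereᵇ 1 x y) 1ℚ)
  ... | no _     | yes refl = trans (∑-cong (allV n q) reorder) (∑-allV-δ x (λ y → 𝟙 (sphereᵇ 1 y z)))
    where
    reorder : ∀ y → 𝟙 (⌊ suc (dist x y) ℕP.≟ 1 ⌋ ∧ sphereᵇ 1 y z) ≡ when (sphereᵇ 0 x y) (𝟙 (sphereᵇ 1 y z))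
    reorder y = trans (cong (λ t → 𝟙 (t ∧ sphereᵇ 1 y z)) (⌊1+d≟1⌋ (dist x y))) (when-∧ (sphereᵇ 0 x y) (sphereᵇ 1 y z) 1ℚ)
  ... | no _     | no _     = trans (∑-cong (allV n q) reorder) (∑-allV-δ x (λ y → 𝟙 (sphereᵇ 0 y z)))
    where
    reorder : ∀ y → 𝟙 (⌊ suc (dist x y) ℕP.≟ 1 ⌋ ∧ ⌊ suc (dist y z) ℕP.≟ 1 ⌋) ≡ when (sphereᵇ 0 x y) (𝟙 (sphereᵇ 0 y z))
    reorder y = trans (cong 𝟙 (cong₂ _∧_ (⌊1+d≟1⌋ (dist x y)) (⌊1+d≟1⌋ (dist y z))))
                      (when-∧ (sphereᵇ 0 x y) (sphereᵇ 0 y z) 1ℚ)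

commonNeighbours≡p₁₁ : ∀ {n q} (x z : Vertex n q) → commonNeighbours x z ≡ p₁₁ q n (dist x z)
commonNeighbours≡p₁₁ {q = q} [] [] = sym (ℚP.*-zeroˡ (ℕtoℚ q - 1ℚ))
commonNeighbours≡p₁₁ {suc n} {q} (a ∷ x) (c ∷ z) with a FinP.≟ c
... | yes refl = begin
  commonNeighbours (a ∷ x) (a ∷ z)          ≡⟨ commonNeighbours-∷ a a x z ⟩
  ∑ (allFin q) (headContribution a a N δ₁ δ₀) ≡⟨ ∑-headContribution-same q a N δ₁ δ₀ ⟩
  N + (ℕtoℚ q - 1ℚ) * δ₀                    ≡⟨ cong (λ t → t + (ℕtoℚ q - 1ℚ) * δ₀) (commonNeighbours≡p₁₁ x z) ⟩
  p₁₁ q n (dist x z) + (ℕtoℚ q - 1ℚ) * δ₀   ≡⟨ p₁₁-suc-sameHead q n (dist x z) ⟩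
  p₁₁ q (suc n) (dist x z)                  ∎
  where
  open ≡-Reasoning
  N  = commonNeighbours x z
  δ₀ = 𝟙 (sphereᵇ 0 x z)
  δ₁ = 𝟙 (sphereᵇ 1 x z)
... | no a≢c = begin
  commonNeighbours (a ∷ x) (c ∷ z)          ≡⟨ commonNeighbours-∷ a c x z ⟩
  ∑ (allFin q) (headContribution a c N δ₁ δ₀) ≡⟨ ∑-headContribution-different q a≢c N δ₁ δ₀ ⟩
  2ℚ * δ₁ + (ℕtoℚ q - 2ℚ) * δ₀              ≡⟨ p₁₁-suc-differentHead q n (dist x z) ⟩
  p₁₁ q (suc n) (suc (dist x z))            ∎
  where
  open ≡-Reasoning
  N  = commonNeighbours x z
  δ₀ = 𝟙 (sphereᵇ 0 x z)
  δ₁ = 𝟙 (sphereᵇ 1 x z)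

A[_] : ∀ {n q} → ℕ → (Vertex n q → ℚ) → Vertex n q → ℚ
A[_] {n} {q} i g x = ∑ (filterᵇ (sphereᵇ i x) (allV n q)) g

A[0] : ∀ {n q} (g : Vertex n q → ℚ) x → A[ 0 ] g x ≡ g x
A[0] {n} {q} g x = trans (∑-filterᵇ _ g (allV n q)) (∑-allV-δ x g)

A-cong : ∀ {n q} i {g h : Vertex n q → ℚ} → (∀ y → g y ≡ h y) → ∀ x → A[ i ] g x ≡ A[ i ] h x
A-cong {n} {q} i eq x = ∑-cong (filterᵇ (sphereᵇ i x) (allV n q)) eq

p₁₁-*-split : ∀ q n D v → p₁₁ q n D * v ≡
  p₁₁ q n 0 * when ⌊ D ℕP.≟ 0 ⌋ v + (p₁₁ q n 1 * when ⌊ D ℕP.≟ 1 ⌋ v + p₁₁ q n 2 * when ⌊ D ℕP.≟ 2 ⌋ v)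
p₁₁-*-split q n D v = split D
  where
  k₀ = p₁₁ q n 0
  k₁ = p₁₁ q n 1
  k₂ = p₁₁ q n 2
  split : ∀ D → p₁₁ q n D * v ≡ k₀ * when ⌊ D ℕP.≟ 0 ⌋ v + (k₁ * when ⌊ D ℕP.≟ 1 ⌋ v + k₂ * when ⌊ D ℕP.≟ 2 ⌋ v)
  split 0 = solve 4 (λ a b c v → a :* v := a :* v :+ (b :* con 0ℚ :+ c :* con 0ℚ)) refl k₀ k₁ k₂ v
  split 1 = solve 4 (λ a b c v → b :* v := a :* con 0ℚ :+ (b :* v :+ c :* con 0ℚ)) refl k₀ k₁ k₂ v
  split 2 = solve 4 (λ a b c v → c :* v := a :* con 0ℚ :+ (b :* con 0ℚ :+ c :* v)) refl k₀ k₁ k₂ v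
  split (suc (suc (suc D))) = solve 4 (λ a b c v → con 0ℚ :* v := a :* con 0ℚ :+ (b :* con 0ℚ :+ c :* con 0ℚ)) refl k₀ k₁ k₂ v

A₁²-expansion : ∀ {n q} (g : Vertex n q → ℚ) x →
  A[ 1 ] (A[ 1 ] g) x ≡ p₁₁ q n 0 * g x + (p₁₁ q n 1 * A[ 1 ] g x + p₁₁ q n 2 * A[ 2 ] g x)
A₁²-expansion {n} {q} g x = begin
  A[ 1 ] (A[ 1 ] g) x
    ≡⟨ ∑-filterᵇ _ _ L ⟩
  ∑ L (λ y → when (sphereᵇ 1 x y) (A[ 1 ] g y))
    ≡⟨ ∑-cong L (λ y → trans (cong (when (sphereᵇ 1 x y)) (∑-filterᵇ _ g L)) (when-∑ (sphereᵇ 1 x y) L _)) ⟩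
  ∑ L (λ y → ∑ L (λ z → when (sphereᵇ 1 x y) (when (sphereᵇ 1 y z) (g z))))
    ≡⟨ ∑-swap L L _ ⟩
  ∑ L (λ z → ∑ L (λ y → when (sphereᵇ 1 x y) (when (sphereᵇ 1 y z) (g z))))
    ≡⟨ ∑-cong L (λ z → trans (commonNeighbours-* z) (cong (_* g z) (commonNeighbours≡p₁₁ x z))) ⟩
  ∑ L (λ z → p₁₁ q n (dist x z) * g z)
    ≡⟨ ∑-cong L (λ z → p₁₁-*-split q n (dist x z) (g z)) ⟩
  ∑ L (λ z → k₀ * S 0 z + (k₁ * S 1 z + k₂ * S 2 z))
    ≡⟨ trans (∑-+ L _ _) (cong (_+_ (∑ L (λ z → k₀ * S 0 z))) (∑-+ L _ _)) ⟩
  ∑ L (λ z → k₀ * S 0 z) + (∑ L (λ z → k₁ * S 1 z) + ∑ L (λ z → k₂ * S 2 z))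
    ≡⟨ cong₂ _+_ (∑-*ˡ L k₀ _) (cong₂ _+_ (∑-*ˡ L k₁ _) (∑-*ˡ L k₂ _)) ⟩
  k₀ * ∑ L (S 0) + (k₁ * ∑ L (S 1) + k₂ * ∑ L (S 2))
    ≡⟨ cong₂ _+_ (cong (k₀ *_) (∑-allV-δ x g))
                 (cong₂ _+_ (cong (k₁ *_) (sym (∑-filterᵇ _ g L))) (cong (k₂ *_) (sym (∑-filterᵇ _ g L)))) ⟩
  k₀ * g x + (k₁ * A[ 1 ] g x + k₂ * A[ 2 ] g x) ∎
  where
  open ≡-Reasoning
  L = allV n q
  k₀ = p₁₁ q n 0
  k₁ = p₁₁ q n 1
  k₂ = p₁₁ q n 2
  S : ℕ → Vertex n q → ℚ
  S i z = when (sphereᵇ i x z) (g z)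
  commonNeighbours-* : ∀ z → ∑ L (λ y → when (sphereᵇ 1 x y) (when (sphereᵇ 1 y z) (g z))) ≡ commonNeighbours x z * g z
  commonNeighbours-* z = trans (∑-cong L (λ y → trans (sym (when-∧ (sphereᵇ 1 x y) _ (g z))) (when-*ʳ _ (g z))))
                               (∑-*ʳ L (g z) _)

-- Weights

ℕtoℚ-countSphere : ∀ {n q} (T : VSet n q) i x → ℕtoℚ (countSphere T i x) ≡ ∑ (allV n q) (λ y → 𝟙 (sphereᵇ i x y ∧ T y))
ℕtoℚ-countSphere {n} {q} T i x = ℕtoℚ-length-filterᵇ _ (allV n q)

A-𝟙≡countSphere : ∀ {n q} (T : VSet n q) i x → A[ i ] (λ y → 𝟙 (T y)) x ≡ ℕtoℚ (countSphere T i x)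
A-𝟙≡countSphere {n} {q} T i x =
  trans (∑-filterᵇ _ _ (allV n q))
        (trans (∑-cong (allV n q) (λ y → sym (when-∧ (sphereᵇ i x y) (T y) 1ℚ))) (sym (ℕtoℚ-countSphere T i x)))

module _ {n q : ℕ} (T₊ T₋ : VSet n q) (disjoint : Disjoint T₊ T₋) where

  charFun-disjoint : ∀ y → charFun T₊ T₋ y ≡ 𝟙 (T₊ y) - 𝟙 (T₋ y)
  charFun-disjoint y with T₊ y in y∈T₊ | T₋ y in y∈T₋
  ... | true  | true  = ⊥-elim (disjoint y y∈T₊ y∈T₋)
  ... | true  | false = refl
  ... | false | true  = refl
  ... | false | false = refl

  A-charFun : ∀ i x → A[ i ] (charFun T₊ T₋) x ≡ ℕtoℚ (countSphere T₊ i x) - ℕtoℚ (countSphere T₋ i x)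
  A-charFun i x = begin
    A[ i ] (charFun T₊ T₋) x                                   ≡⟨ ∑-cong S charFun-disjoint ⟩
    ∑ S (λ y → 𝟙 (T₊ y) + - 𝟙 (T₋ y))                          ≡⟨ ∑-+ S _ _ ⟩
    A[ i ] (λ y → 𝟙 (T₊ y)) x + ∑ S (λ y → - 𝟙 (T₋ y))         ≡⟨ cong (_+_ (A[ i ] (λ y → 𝟙 (T₊ y)) x)) (∑-neg S _) ⟩
    A[ i ] (λ y → 𝟙 (T₊ y)) x - A[ i ] (λ y → 𝟙 (T₋ y)) x      ≡⟨ cong₂ _-_ (A-𝟙≡countSphere T₊ i x) (A-𝟙≡countSphere T₋ i x) ⟩
    ℕtoℚ (countSphere T₊ i x) - ℕtoℚ (countSphere T₋ i x)      ∎
    where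
    open ≡-Reasoning
    S = filterᵇ (sphereᵇ i x) (allV n q)

scaledWeight : ∀ {n q} → VSet n q → Vertex n q → ℕ
scaledWeight {n} T x = n ℕ.* countSphere T 0 x ℕ.+ n ℕ.* countSphere T 1 x ℕ.+ 2 ℕ.* countSphere T 2 x

ℕtoℚ-scaledWeight : ∀ {n q} (T : VSet n q) x → ℕtoℚ (scaledWeight T x) ≡
  ℕtoℚ n * ℕtoℚ (countSphere T 0 x) + ℕtoℚ n * ℕtoℚ (countSphere T 1 x) + 2ℚ * ℕtoℚ (countSphere T 2 x)
ℕtoℚ-scaledWeight {n} T x =
  trans (ℕtoℚ-+ (n ℕ.* c₀ ℕ.+ n ℕ.* c₁) (2 ℕ.* c₂))
        (cong₂ _+_ (trans (ℕtoℚ-+ (n ℕ.* c₀) (n ℕ.* c₁)) (cong₂ _+_ (ℕtoℚ-* n c₀) (ℕtoℚ-* n c₁))) (ℕtoℚ-* 2 c₂))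
  where
  c₀ = countSphere T 0 x
  c₁ = countSphere T 1 x
  c₂ = countSphere T 2 x

module _ {q m : ℕ} where

  n*w≡scaledWeight : (T : VSet (suc m) q) (x : Vertex (suc m) q) → ℕtoℚ (suc m) * w T x ≡ ℕtoℚ (scaledWeight T x)
  n*w≡scaledWeight T x = begin
    N * (ℕtoℚ c₀ + ℕtoℚ c₁ + (+ (2 ℕ.* c₂)) / suc m)
      ≡⟨ solve 4 (λ N a b r → N :* (a :+ b :+ r) := N :* a :+ N :* b :+ N :* r) refl N (ℕtoℚ c₀) (ℕtoℚ c₁) ((+ (2 ℕ.* c₂)) / suc m) ⟩
    N * ℕtoℚ c₀ + N * ℕtoℚ c₁ + N * ((+ (2 ℕ.* c₂)) / suc m)
      ≡⟨ cong (_+_ (N * ℕtoℚ c₀ + N * ℕtoℚ c₁)) (trans (n*[k/n]≡k m (2 ℕ.* c₂)) (ℕtoℚ-* 2 c₂)) ⟩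
    N * ℕtoℚ c₀ + N * ℕtoℚ c₁ + 2ℚ * ℕtoℚ c₂
      ≡⟨ sym (ℕtoℚ-scaledWeight T x) ⟩
    ℕtoℚ (scaledWeight T x) ∎
    where
    open ≡-Reasoning
    N  = ℕtoℚ (suc m)
    c₀ = countSphere T 0 x
    c₁ = countSphere T 1 x
    c₂ = countSphere T 2 x

  w≡w⇔scaledWeight≡ : (T T′ : VSet (suc m) q) (x : Vertex (suc m) q) → (w T x ≡ w T′ x) ⇔ (scaledWeight T x ≡ scaledWeight T′ x)
  w≡w⇔scaledWeight≡ T T′ x = mk⇔
    (λ eq → ℕtoℚ-injective (trans (sym (n*w≡scaledWeight T x)) (trans (cong (ℕtoℚ (suc m) *_) eq) (n*w≡scaledWeight T′ x))))
    (λ eq → ℕtoℚ-suc-*-cancelˡ m (trans (n*w≡scaledWeight T x) (trans (cong ℕtoℚ eq) (sym (n*w≡scaledWeight T′ x)))))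

  w≤1⇔scaledWeight≤n : (T : VSet (suc m) q) (x : Vertex (suc m) q) → (w T x ≤ℚ 1ℚ) ⇔ (scaledWeight T x ≤ suc m)
  w≤1⇔scaledWeight≤n T x = mk⇔
    (λ w≤1 → ℕtoℚ-cancel-≤ (subst₂ _≤ℚ_ (n*w≡scaledWeight T x) (ℚP.*-identityʳ N)
                              (ℚP.*-monoˡ-≤-nonNeg N {{ℕtoℚ-nonNegative (suc m)}} w≤1)))
    (λ U≤n → ℚP.*-cancelˡ-≤-pos N {{ℕtoℚ-suc-positive m}}
               (subst₂ _≤ℚ_ (sym (n*w≡scaledWeight T x)) (sym (ℚP.*-identityʳ N)) (ℕtoℚ-mono-≤ U≤n)))
    where N = ℕtoℚ (suc m)

ℕtoℚ-scaledWeight-∑ : ∀ {n q} (T : VSet n q) x → ℕtoℚ (scaledWeight T x) ≡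
  ∑ (allV n q) (λ z → 𝟙 (T z) * (ℕtoℚ n * 𝟙 (sphereᵇ 0 x z) + ℕtoℚ n * 𝟙 (sphereᵇ 1 x z) + 2ℚ * 𝟙 (sphereᵇ 2 x z)))
ℕtoℚ-scaledWeight-∑ {n} {q} T x = begin
  ℕtoℚ (scaledWeight T x)
    ≡⟨ ℕtoℚ-scaledWeight T x ⟩
  N * ℕtoℚ (countSphere T 0 x) + N * ℕtoℚ (countSphere T 1 x) + 2ℚ * ℕtoℚ (countSphere T 2 x)
    ≡⟨ cong₂ _+_ (cong₂ _+_ (count 0 N) (count 1 N)) (count 2 2ℚ) ⟩
  ∑ L (λ z → N * 𝟙 (S 0 z)) + ∑ L (λ z → N * 𝟙 (S 1 z)) + ∑ L (λ z → 2ℚ * 𝟙 (S 2 z))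
    ≡⟨ sym (trans (∑-+ L _ _) (cong (_+ ∑ L (λ z → 2ℚ * 𝟙 (S 2 z))) (∑-+ L _ _))) ⟩
  ∑ L (λ z → N * 𝟙 (S 0 z) + N * 𝟙 (S 1 z) + 2ℚ * 𝟙 (S 2 z))
    ≡⟨ ∑-cong L factor ⟩
  ∑ L (λ z → 𝟙 (T z) * (N * 𝟙 (sphereᵇ 0 x z) + N * 𝟙 (sphereᵇ 1 x z) + 2ℚ * 𝟙 (sphereᵇ 2 x z))) ∎
  where
  open ≡-Reasoning
  L = allV n q
  N = ℕtoℚ n
  S : ℕ → Vertex n q → Bool
  S i z = sphereᵇ i x z ∧ T z
  count : ∀ i c → c * ℕtoℚ (countSphere T i x) ≡ ∑ L (λ z → c * 𝟙 (S i z))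
  count i c = trans (cong (c *_) (ℕtoℚ-countSphere T i x)) (sym (∑-*ˡ L c _))
  factor : ∀ z → N * 𝟙 (S 0 z) + N * 𝟙 (S 1 z) + 2ℚ * 𝟙 (S 2 z) ≡
                 𝟙 (T z) * (N * 𝟙 (sphereᵇ 0 x z) + N * 𝟙 (sphereᵇ 1 x z) + 2ℚ * 𝟙 (sphereᵇ 2 x z))
  factor z rewrite 𝟙-∧ (sphereᵇ 0 x z) (T z) | 𝟙-∧ (sphereᵇ 1 x z) (T z) | 𝟙-∧ (sphereᵇ 2 x z) (T z) =
    solve 5 (λ N t a b c → N :* (a :* t) :+ N :* (b :* t) :+ con 2ℚ :* (c :* t) := t :* (N :* a :+ N :* b :+ con 2ℚ :* c))
          refl N (𝟙 (T z)) (𝟙 (sphereᵇ 0 x z)) (𝟙 (sphereᵇ 1 x z)) (𝟙 (sphereᵇ 2 x z))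

-- Codes with minimum distance 4

countSphere≥1 : ∀ {n q} (T : VSet n q) i (x : Vertex n q) {y : Vertex n q} → T y ≡ true → dist x y ≡ i → 1 ≤ countSphere T i x
countSphere≥1 {n} {q} T i x {y} y∈T d = ℕtoℚ-cancel-≤ (begin
  1ℚ                                       ≡⟨ sym (∑-allV-δ y (λ _ → 1ℚ)) ⟩
  ∑ (allV n q) (λ z → 𝟙 (sphereᵇ 0 y z))    ≤⟨ ∑-mono-≤ (allV n q) (λ z → 𝟙-mono-≤ (only-y z)) ⟩
  ∑ (allV n q) (λ z → 𝟙 (sphereᵇ i x z ∧ T z)) ≡⟨ sym (ℕtoℚ-countSphere T i x) ⟩
  ℕtoℚ (countSphere T i x)                 ∎)
  where
  open ℚP.≤-Reasoning
  only-y : ∀ z → sphereᵇ 0 y z ≡ true → (sphereᵇ i x z ∧ T z) ≡ true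
  only-y z s with sphereᵇ-0⇒≡ y z s
  ... | refl rewrite sphereᵇ-intro x y d | y∈T = refl

module WeightBound {q m : ℕ} (T : VSet (suc m) q) (x : Vertex (suc m) q) (bound : scaledWeight T x ≤ suc m) where

  private
    n c₀ c₁ c₂ : ℕ
    n  = suc m
    c₀ = countSphere T 0 x
    c₁ = countSphere T 1 x
    c₂ = countSphere T 2 x

    n≤n* : ∀ {c} → 1 ≤ c → n ≤ n ℕ.* c
    n≤n* 1≤c = ℕP.≤-trans (ℕP.≤-reflexive (sym (ℕP.*-identityʳ n))) (ℕP.*-monoʳ-≤ n 1≤c)

    exceeds : ∀ {k} → n ℕ.+ suc k ≤ scaledWeight T x → ⊥
    exceeds le = ℕP.m+1+n≰m n (ℕP.≤-trans le bound)

  c₀c₁-exclusive : 1 ≤ c₀ → 1 ≤ c₁ → ⊥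
  c₀c₁-exclusive h₀ h₁ = exceeds (ℕP.≤-trans (ℕP.+-mono-≤ (n≤n* h₀) (n≤n* h₁)) (ℕP.m≤m+n _ (2 ℕ.* c₂)))

  c₀c₂-exclusive : 1 ≤ c₀ → 1 ≤ c₂ → ⊥
  c₀c₂-exclusive h₀ h₂ = exceeds {1} (ℕP.+-mono-≤ (ℕP.≤-trans (n≤n* h₀) (ℕP.m≤m+n _ (n ℕ.* c₁))) (ℕP.*-monoʳ-≤ 2 h₂))

  c₁c₂-exclusive : 1 ≤ c₁ → 1 ≤ c₂ → ⊥
  c₁c₂-exclusive h₁ h₂ = exceeds {1} (ℕP.+-mono-≤ (ℕP.≤-trans (n≤n* h₁) (ℕP.m≤n+m _ (n ℕ.* c₀))) (ℕP.*-monoʳ-≤ 2 h₂))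

  c₁≤1 : c₁ ≤ 1
  c₁≤1 = ℕP.*-cancelˡ-≤ n (ℕP.≤-trans (ℕP.≤-trans (ℕP.m≤n+m _ (n ℕ.* c₀)) (ℕP.m≤m+n _ (2 ℕ.* c₂)))
                                        (ℕP.≤-trans bound (ℕP.≤-reflexive (sym (ℕP.*-identityʳ n)))))

scaledWeight≤n⇒code : ∀ {q m} (T : VSet (suc m) q) → (∀ x → scaledWeight T x ≤ suc m) → IsCode T 4
scaledWeight≤n⇒code T bound x y x∈T y∈T x≢y with dist x y in d
... | 0 = ⊥-elim (x≢y (dist≡0⇒≡ x y d))
... | 1 = ⊥-elim (WeightBound.c₀c₁-exclusive T x (bound x) (countSphere≥1 T 0 x x∈T (dist-refl x)) (countSphere≥1 T 1 x y∈T d))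
... | 2 = ⊥-elim (WeightBound.c₀c₂-exclusive T x (bound x) (countSphere≥1 T 0 x x∈T (dist-refl x)) (countSphere≥1 T 2 x y∈T d))
... | 3 with midpoint x y 2 d
...   | z , d₁ , d₂ = ⊥-elim (WeightBound.c₁c₂-exclusive T z (bound z) (countSphere≥1 T 1 z x∈T (trans (dist-sym z x) d₁))
                                                      (countSphere≥1 T 2 z y∈T d₂))
scaledWeight≤n⇒code T bound x y x∈T y∈T x≢y | suc (suc (suc (suc _))) = s≤s (s≤s (s≤s (s≤s z≤n)))

∧≡true⇒ : ∀ {a b} → a ∧ b ≡ true → a ≡ true × b ≡ true
∧≡true⇒ {true} {true} _ = refl , refl

-- Charge a codeword at distance at most 1 from x to every coordinate, and one at distance 2 to the
-- two coordinates in which it differs from x. The charges add up to n·w(x), and in a code of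
-- minimum distance 4 no coordinate is charged twice.
charge : ℕ → Bool → Bool
charge 0                   _       = true
charge 1                   _       = true
charge 2                   differs = differs
charge (suc (suc (suc _))) _       = false

charge≤2 : ∀ D b → charge D b ≡ true → D ≤ 2
charge≤2 0 _ _ = z≤n
charge≤2 1 _ _ = s≤s z≤n
charge≤2 2 _ _ = s≤s (s≤s z≤n)

charge-cases : ∀ D b → charge D b ≡ true → D ≤ 1 ⊎ (D ≡ 2 × b ≡ true)
charge-cases 0 _ _  = inj₁ z≤n
charge-cases 1 _ _  = inj₁ (s≤s z≤n)
charge-cases 2 _ eq = inj₂ (refl , eq)

sharedCharge⇒dist≤3 : ∀ {n q} (x z z′ : Vertex n q) i → charge (dist x z) (differsAt x z i) ≡ true →
                      charge (dist x z′) (differsAt x z′ i) ≡ true → dist z z′ ≤ 3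
sharedCharge⇒dist≤3 x z z′ i ch ch′ with charge-cases (dist x z) _ ch | charge-cases (dist x z′) _ ch′
... | inj₁ near | _ =
  ℕP.≤-trans (dist-triangle z x z′) (ℕP.+-mono-≤ (subst (_≤ 1) (dist-sym x z) near) (charge≤2 _ _ ch′))
... | inj₂ _ | inj₁ near′ =
  ℕP.≤-trans (dist-triangle z x z′) (ℕP.+-mono-≤ (subst (_≤ 2) (dist-sym x z) (charge≤2 _ _ ch)) near′)
... | inj₂ (d , diff) | inj₂ (d′ , diff′) = ℕP.≤-pred (ℕP.≤-trans
  (dist-triangle-sharedMismatch x z z′ i (differsAt⇒≢ x z i diff) (differsAt⇒≢ x z′ i diff′))
  (ℕP.≤-reflexive (cong₂ ℕ._+_ (trans (dist-sym z x) d) d′)))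

∑-charge : ∀ {n q} (x z : Vertex n q) →
  ∑ (allFin n) (λ i → 𝟙 (charge (dist x z) (differsAt x z i))) ≡
  ℕtoℚ n * 𝟙 ⌊ dist x z ℕP.≟ 0 ⌋ + ℕtoℚ n * 𝟙 ⌊ dist x z ℕP.≟ 1 ⌋ + 2ℚ * 𝟙 ⌊ dist x z ℕP.≟ 2 ⌋
∑-charge {n} x z with dist x z | ℕtoℚ-dist x z
... | 0 | _ = trans (∑-allFin-const n 1ℚ)
  (solve 1 (λ N → N :* con 1ℚ := N :* con 1ℚ :+ N :* con 0ℚ :+ con 2ℚ :* con 0ℚ) refl (ℕtoℚ n))
... | 1 | _ = trans (∑-allFin-const n 1ℚ)
  (solve 1 (λ N → N :* con 1ℚ := N :* con 0ℚ :+ N :* con 1ℚ :+ con 2ℚ :* con 0ℚ) refl (ℕtoℚ n))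
... | 2 | dist≡∑ = trans (sym dist≡∑)
  (solve 1 (λ N → con 2ℚ := N :* con 0ℚ :+ N :* con 0ℚ :+ con 2ℚ :* con 1ℚ) refl (ℕtoℚ n))
... | suc (suc (suc _)) | _ = trans (∑-zero (allFin n))
  (solve 1 (λ N → con 0ℚ := N :* con 0ℚ :+ N :* con 0ℚ :+ con 2ℚ :* con 0ℚ) refl (ℕtoℚ n))

code⇒scaledWeight≤n : ∀ {q m} (T : VSet (suc m) q) → IsCode T 4 → ∀ x → scaledWeight T x ≤ suc m
code⇒scaledWeight≤n {q} {m} T code x = ℕtoℚ-cancel-≤ (begin
  ℕtoℚ (scaledWeight T x)
    ≡⟨ ℕtoℚ-scaledWeight-∑ T x ⟩
  ∑ L (λ z → 𝟙 (T z) * (N * 𝟙 (sphereᵇ 0 x z) + N * 𝟙 (sphereᵇ 1 x z) + 2ℚ * 𝟙 (sphereᵇ 2 x z)))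
    ≡⟨ ∑-cong L (λ z → cong (𝟙 (T z) *_) (sym (∑-charge x z))) ⟩
  ∑ L (λ z → 𝟙 (T z) * ∑ I (λ i → 𝟙 (charge (dist x z) (differsAt x z i))))
    ≡⟨ ∑-cong L (λ z → trans (sym (∑-*ˡ I (𝟙 (T z)) _)) (∑-cong I (λ i → sym (𝟙-∧ (T z) _)))) ⟩
  ∑ L (λ z → ∑ I (λ i → 𝟙 (charged z i)))
    ≡⟨ ∑-swap L I _ ⟩
  ∑ I (λ i → ∑ L (λ z → 𝟙 (charged z i)))
    ≤⟨ ∑-mono-≤ I (λ i → ∑-𝟙-atMostOne (λ z → charged z i) (charged-unique i)) ⟩
  ∑ I (λ _ → 1ℚ)
    ≡⟨ trans (∑-allFin-const (suc m) 1ℚ) (ℚP.*-identityʳ N) ⟩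
  N ∎)
  where
  open ℚP.≤-Reasoning
  L = allV (suc m) q
  I = allFin (suc m)
  N = ℕtoℚ (suc m)

  charged : Vertex (suc m) q → Fin (suc m) → Bool
  charged z i = T z ∧ charge (dist x z) (differsAt x z i)

  charged-unique : ∀ i z z′ → charged z i ≡ true → charged z′ i ≡ true → z ≡ z′
  charged-unique i z z′ cz cz′ with VecP.≡-dec FinP._≟_ z z′
  ... | yes z≡z′ = z≡z′
  ... | no z≢z′  = ⊥-elim (ℕP.≤⇒≯ (sharedCharge⇒dist≤3 x z z′ i (proj₂ (∧≡true⇒ cz)) (proj₂ (∧≡true⇒ cz′)))
                            (code z z′ (proj₁ (∧≡true⇒ cz)) (proj₁ (∧≡true⇒ cz′)) z≢z′))

-- The matrix F

balance : ∀ {n q} → (Vertex n q → ℚ) → Vertex n q → ℚ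
balance {n} g x = ℕtoℚ n * g x + ℕtoℚ n * A[ 1 ] g x + 2ℚ * A[ 2 ] g x

F⋆ : ∀ {n q} → (Vertex n q → ℚ) → Mat3 n q
F⋆ g x zero             = g x
F⋆ g x (suc zero)       = A[ 1 ] g x
F⋆ g x (suc (suc zero)) = - (g x + A[ 1 ] g x)

F⋆-rowSum : ∀ {n q} (g : Vertex n q → ℚ) x → rowSum (F⋆ g) x ≡ 0ℚ
F⋆-rowSum g x = solve 2 (λ g a → g :+ (a :+ (:- (g :+ a) :+ con 0ℚ)) := con 0ℚ) refl (g x) (A[ 1 ] g x)

rowSum≡0⇒third : ∀ a b c → a + (b + (c + 0ℚ)) ≡ 0ℚ → c ≡ - (a + b)
rowSum≡0⇒third a b c sum≡0 = begin
  c                                 ≡⟨ solve 3 (λ a b c → c := (a :+ (b :+ (c :+ con 0ℚ))) :+ :- (a :+ b)) refl a b c ⟩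
  (a + (b + (c + 0ℚ))) + - (a + b)  ≡⟨ cong (_+ - (a + b)) sum≡0 ⟩
  0ℚ + - (a + b)                    ≡⟨ ℚP.+-identityˡ _ ⟩
  - (a + b)                         ∎
  where open ≡-Reasoning

module _ {q m : ℕ} (2≤q : 2 ≤ q) where

  private
    N Q k₀ k₁ : ℚ
    N  = ℕtoℚ (suc m)
    Q  = ℕtoℚ q
    k₀ = p₁₁ q (suc m) 0
    k₁ = p₁₁ q (suc m) 1
    1≤q : 1 ≤ q
    1≤q = ℕP.≤-trans (s≤s z≤n) 2≤q

  Smat₀₁≡p₁₁ : ℕtoℚ (suc m ℕ.* (q ∸ 1)) ≡ k₀
  Smat₀₁≡p₁₁ = trans (ℕtoℚ-* (suc m) (q ∸ 1)) (cong (N *_) (ℕtoℚ-∸ q 1 1≤q))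

  Smat₁₁≡p₁₁ : ℕtoℚ (q ∸ 2) ≡ k₁
  Smat₁₁≡p₁₁ = ℕtoℚ-∸ q 2 2≤q

  Smat₁₂≡ : ℕtoℚ ((suc m ∸ 1) ℕ.* (q ∸ 1)) ≡ (N - 1ℚ) * (Q - 1ℚ)
  Smat₁₂≡ = trans (ℕtoℚ-* (suc m ∸ 1) (q ∸ 1)) (cong₂ _*_ (ℕtoℚ-∸ (suc m) 1 (s≤s z≤n)) (ℕtoℚ-∸ q 1 1≤q))

  Smat₂₂≡ : ℕtoℚ (suc m ℕ.* (q ∸ 2)) ≡ N * (Q - 2ℚ)
  Smat₂₂≡ = trans (ℕtoℚ-* (suc m) (q ∸ 2)) (cong (N *_) (ℕtoℚ-∸ q 2 2≤q))

  eigenmatrix⇒balance≡0 : (g : Vertex (suc m) q → ℚ) (F : Mat3 (suc m) q) → (∀ x → F x zero ≡ g x) →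
    (∀ x → rowSum F x ≡ 0ℚ) → (∀ x j → AF F x j ≡ FS F x j) → ∀ x → balance g x ≡ 0ℚ
  eigenmatrix⇒balance≡0 g F col₀ rowSum≡0 AF≡FS x = begin
    balance g x
      ≡⟨ solve 6 (λ N k₀ k₁ g a₁ a₂ → N :* g :+ N :* a₁ :+ con 2ℚ :* a₂ :=
                    (k₀ :* g :+ (k₁ :* a₁ :+ con 2ℚ :* a₂)) :- (g :* k₀ :+ (a₁ :* k₁ :+ (:- (g :+ a₁) :* N :+ con 0ℚ))))
                 refl N k₀ k₁ (g x) a₁ (A[ 2 ] g x) ⟩
    (k₀ * g x + (k₁ * a₁ + 2ℚ * A[ 2 ] g x)) - R  ≡⟨ cong (_- R) (trans (sym (A₁²-expansion g x)) A₁²≡R) ⟩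
    R - R                                        ≡⟨ ℚP.+-inverseʳ R ⟩
    0ℚ                                           ∎
    where
    open ≡-Reasoning
    a₁ = A[ 1 ] g x
    R = g x * k₀ + (a₁ * k₁ + (- (g x + a₁) * N + 0ℚ))
    col₁ : ∀ y → F y (suc zero) ≡ A[ 1 ] g y
    col₁ y = trans (solve 3 (λ a b c → b := a :* con 0ℚ :+ (b :* con 1ℚ :+ (c :* con 0ℚ :+ con 0ℚ))) refl
                            (F y zero) (F y (suc zero)) (F y (suc (suc zero))))
                   (trans (sym (AF≡FS y zero)) (A-cong 1 col₀ y))
    col₂ : F x (suc (suc zero)) ≡ - (g x + a₁)
    col₂ = trans (rowSum≡0⇒third (F x zero) (F x (suc zero)) _ (rowSum≡0 x)) (cong -_ (cong₂ _+_ (col₀ x) (col₁ x)))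
    A₁²≡R : A[ 1 ] (A[ 1 ] g) x ≡ R
    A₁²≡R = trans (A-cong 1 (λ y → sym (col₁ y)) x)
      (trans (AF≡FS x (suc zero))
        (cong₂ _+_ (cong₂ _*_ (col₀ x) Smat₀₁≡p₁₁)
                   (cong₂ (λ u v → u + (v * N + 0ℚ)) (cong₂ _*_ (col₁ x) Smat₁₁≡p₁₁) col₂)))

  F⋆-eigenmatrix : (g : Vertex (suc m) q → ℚ) → (∀ x → balance g x ≡ 0ℚ) → ∀ x j → AF (F⋆ g) x j ≡ FS (F⋆ g) x j
  F⋆-eigenmatrix g balanced x zero =
    solve 2 (λ g a → a := g :* con 0ℚ :+ (a :* con 1ℚ :+ (:- (g :+ a) :* con 0ℚ :+ con 0ℚ))) refl (g x) (A[ 1 ] g x)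
  F⋆-eigenmatrix g balanced x (suc zero) = begin
    A[ 1 ] (A[ 1 ] g) x                       ≡⟨ A₁²-expansion g x ⟩
    k₀ * g x + (k₁ * a₁ + 2ℚ * a₂)
      ≡⟨ solve 5 (λ N Q g a₁ a₂ → N :* (Q :- con 1ℚ) :* g :+ ((Q :- con 2ℚ) :* a₁ :+ con 2ℚ :* a₂) :=
                    (g :* (N :* (Q :- con 1ℚ)) :+ (a₁ :* (Q :- con 2ℚ) :+ (:- (g :+ a₁) :* N :+ con 0ℚ)))
                    :+ (N :* g :+ N :* a₁ :+ con 2ℚ :* a₂)) refl N Q (g x) a₁ a₂ ⟩
    R + balance g x                           ≡⟨ cong (_+_ R) (balanced x) ⟩
    R + 0ℚ                                    ≡⟨ ℚP.+-identityʳ R ⟩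
    R                                         ≡⟨ sym (cong₂ (λ u v → g x * u + (a₁ * v + (- (g x + a₁) * N + 0ℚ))) Smat₀₁≡p₁₁ Smat₁₁≡p₁₁) ⟩
    FS (F⋆ g) x (suc zero)                    ∎
    where
    open ≡-Reasoning
    a₁ = A[ 1 ] g x
    a₂ = A[ 2 ] g x
    R = g x * k₀ + (a₁ * k₁ + (- (g x + a₁) * N + 0ℚ))
  F⋆-eigenmatrix g balanced x (suc (suc zero)) = begin
    A[ 1 ] (λ y → - (g y + A[ 1 ] g y)) x     ≡⟨ trans (∑-neg S _) (cong -_ (∑-+ S g (A[ 1 ] g))) ⟩
    - (a₁ + A[ 1 ] (A[ 1 ] g) x)              ≡⟨ cong (λ t → - (a₁ + t)) (A₁²-expansion g x) ⟩
    - (a₁ + (k₀ * g x + (k₁ * a₁ + 2ℚ * a₂)))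
      ≡⟨ solve 5 (λ N Q g a₁ a₂ → :- (a₁ :+ (N :* (Q :- con 1ℚ) :* g :+ ((Q :- con 2ℚ) :* a₁ :+ con 2ℚ :* a₂))) :=
                    (g :* con 0ℚ :+ (a₁ :* ((N :- con 1ℚ) :* (Q :- con 1ℚ)) :+ (:- (g :+ a₁) :* (N :* (Q :- con 2ℚ)) :+ con 0ℚ)))
                    :+ (:- (N :* g :+ N :* a₁ :+ con 2ℚ :* a₂))) refl N Q (g x) a₁ a₂ ⟩
    R + - balance g x                         ≡⟨ cong (λ t → R + - t) (balanced x) ⟩
    R + - 0ℚ                                  ≡⟨ ℚP.+-identityʳ R ⟩
    R                                         ≡⟨ sym (cong₂ (λ u v → g x * 0ℚ + (a₁ * u + (- (g x + a₁) * v + 0ℚ))) Smat₁₂≡ Smat₂₂≡) ⟩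
    FS (F⋆ g) x (suc (suc zero))              ∎
    where
    open ≡-Reasoning
    S  = filterᵇ (sphereᵇ 1 x) (allV (suc m) q)
    a₁ = A[ 1 ] g x
    a₂ = A[ 2 ] g x
    R = g x * 0ℚ + (a₁ * ((N - 1ℚ) * (Q - 1ℚ)) + (- (g x + a₁) * (N * (Q - 2ℚ)) + 0ℚ))

rowNonzeros≤2 : ∀ {n q} (F : Mat3 n q) x →
  F x zero ≡ 0ℚ ⊎ F x (suc zero) ≡ 0ℚ ⊎ F x (suc (suc zero)) ≡ 0ℚ → rowNonzeros F x ≤ 2
rowNonzeros≤2 F x zeroEntry = ℕP.≤-pred (ListP.filter-notAll (λ j → ¬? (F x j ℚP.≟ 0ℚ)) (allFin 3) (position zeroEntry))
  where
  position : F x zero ≡ 0ℚ ⊎ F x (suc zero) ≡ 0ℚ ⊎ F x (suc (suc zero)) ≡ 0ℚ →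
             Any (λ j → ¬ (F x j ≢ 0ℚ)) (allFin 3)
  position (inj₁ e)        = here (λ ≢0 → ≢0 e)
  position (inj₂ (inj₁ e)) = there (here (λ ≢0 → ≢0 e))
  position (inj₂ (inj₂ e)) = there (there (here (λ ≢0 → ≢0 e)))

cancelsWithinOne : ∀ {u a : ℚ} {c} → c ≤ 1 →
  (u ≡ 1ℚ × a ≡ 0ℚ - ℕtoℚ c) ⊎ (u ≡ - 1ℚ × a ≡ ℕtoℚ c - 0ℚ) → a ≡ 0ℚ ⊎ - (u + a) ≡ 0ℚ
cancelsWithinOne z≤n       (inj₁ (refl , refl)) = inj₁ refl
cancelsWithinOne (s≤s z≤n) (inj₁ (refl , refl)) = inj₂ refl
cancelsWithinOne z≤n       (inj₂ (refl , refl)) = inj₁ refl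
cancelsWithinOne (s≤s z≤n) (inj₂ (refl , refl)) = inj₂ refl

module _ {q m : ℕ} (T₊ T₋ : VSet (suc m) q) (disjoint : Disjoint T₊ T₋) where

  private
    f : Vertex (suc m) q → ℚ
    f = charFun T₊ T₋

    N : ℚ
    N = ℕtoℚ (suc m)

  balance-charFun : ∀ x → balance f x ≡ ℕtoℚ (scaledWeight T₊ x) - ℕtoℚ (scaledWeight T₋ x)
  balance-charFun x = begin
    N * f x + N * A[ 1 ] f x + 2ℚ * A[ 2 ] f x
      ≡⟨ cong₂ _+_ (cong₂ _+_ (cong (N *_) (trans (sym (A[0] f x)) (A-charFun T₊ T₋ disjoint 0 x)))
                              (cong (N *_) (A-charFun T₊ T₋ disjoint 1 x)))
                   (cong (2ℚ *_) (A-charFun T₊ T₋ disjoint 2 x)) ⟩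
    N * (P 0 - M 0) + N * (P 1 - M 1) + 2ℚ * (P 2 - M 2)
      ≡⟨ solve 7 (λ N p₀ p₁ p₂ m₀ m₁ m₂ → N :* (p₀ :- m₀) :+ N :* (p₁ :- m₁) :+ con 2ℚ :* (p₂ :- m₂) :=
                    (N :* p₀ :+ N :* p₁ :+ con 2ℚ :* p₂) :- (N :* m₀ :+ N :* m₁ :+ con 2ℚ :* m₂))
                 refl N (P 0) (P 1) (P 2) (M 0) (M 1) (M 2) ⟩
    (N * P 0 + N * P 1 + 2ℚ * P 2) - (N * M 0 + N * M 1 + 2ℚ * M 2)
      ≡⟨ sym (cong₂ _-_ (ℕtoℚ-scaledWeight T₊ x) (ℕtoℚ-scaledWeight T₋ x)) ⟩
    ℕtoℚ (scaledWeight T₊ x) - ℕtoℚ (scaledWeight T₋ x) ∎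
    where
    open ≡-Reasoning
    P M : ℕ → ℚ
    P i = ℕtoℚ (countSphere T₊ i x)
    M i = ℕtoℚ (countSphere T₋ i x)

  balance≡0⇔scaledWeight≡ : ∀ x → (balance f x ≡ 0ℚ) ⇔ (scaledWeight T₊ x ≡ scaledWeight T₋ x)
  balance≡0⇔scaledWeight≡ x = mk⇔
    (λ b≡0 → ℕtoℚ-injective (x-y≡0⇒x≡y _ _ (trans (sym (balance-charFun x)) b≡0)))
    (λ eq → trans (balance-charFun x) (trans (cong (λ k → ℕtoℚ k - ℕtoℚ (scaledWeight T₋ x)) eq)
                                             (ℚP.+-inverseʳ (ℕtoℚ (scaledWeight T₋ x)))))

  F⋆-rowNonzeros≤2 : (∀ x → scaledWeight T₊ x ≤ suc m) → (∀ x → scaledWeight T₋ x ≤ suc m) →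
                     ∀ x → rowNonzeros (F⋆ f) x ≤ 2
  F⋆-rowNonzeros≤2 bound₊ bound₋ x = rowNonzeros≤2 (F⋆ f) x zeroEntry
    where
    noCloseNeighbour : (T : VSet (suc m) q) → (∀ x → scaledWeight T x ≤ suc m) → T x ≡ true → countSphere T 1 x ≡ 0
    noCloseNeighbour T bound x∈T = ℕP.n<1⇒n≡0 (ℕP.≰⇒> (WeightBound.c₀c₁-exclusive T x (bound x)
                                                         (countSphere≥1 T 0 x x∈T (dist-refl x))))
    A-f : A[ 1 ] f x ≡ ℕtoℚ (countSphere T₊ 1 x) - ℕtoℚ (countSphere T₋ 1 x)
    A-f = A-charFun T₊ T₋ disjoint 1 x
    zeroEntry : f x ≡ 0ℚ ⊎ A[ 1 ] f x ≡ 0ℚ ⊎ - (f x + A[ 1 ] f x) ≡ 0ℚ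
    zeroEntry with T₊ x in x∈T₊ | T₋ x in x∈T₋
    ... | true  | true  = ⊥-elim (disjoint x x∈T₊ x∈T₋)
    ... | true  | false = inj₂ (cancelsWithinOne (WeightBound.c₁≤1 T₋ x (bound₋ x))
        (inj₁ (refl , trans A-f (cong (λ k → ℕtoℚ k - ℕtoℚ (countSphere T₋ 1 x)) (noCloseNeighbour T₊ bound₊ x∈T₊)))))
    ... | false | true  = inj₂ (cancelsWithinOne (WeightBound.c₁≤1 T₊ x (bound₊ x))
        (inj₂ (refl , trans A-f (cong (λ k → ℕtoℚ (countSphere T₊ 1 x) - ℕtoℚ k) (noCloseNeighbour T₋ bound₋ x∈T₋)))))
    ... | false | false = inj₁ refl

proposition2 : (q n : ℕ) → 3 ≤ q → .{{_ : NonZero n}} →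
  (T₊ T₋ : VSet n q) → Disjoint T₊ T₋ →
  ((IsCode T₊ 4 × IsCode T₋ 4 ×
    Σ (Mat3 n q) (λ F →
      (∀ x → F x zero ≡ charFun T₊ T₋ x) ×
      (∀ x → rowSum F x ≡ 0ℚ) ×
      (∀ x → rowNonzeros F x ≤ 2) ×
      (∀ x j → AF F x j ≡ FS F x j)))
   ⇔
   (∀ x → (w T₊ x ≡ w T₋ x) × (w T₊ x ≤ℚ 1ℚ)))
proposition2 q 0       _   T₊ T₋ _        = ⊥-elim (ℕ.≢-nonZero⁻¹ 0 refl)
proposition2 q (suc m) 3≤q T₊ T₋ disjoint = mk⇔
  (λ (code₊ , _ , F , col₀ , rowSum≡0 , _ , AF≡FS) x →
     Equivalence.from (w≡w⇔scaledWeight≡ T₊ T₋ x)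
       (Equivalence.to (balance≡0⇔scaledWeight≡ T₊ T₋ disjoint x)
         (eigenmatrix⇒balance≡0 2≤q f F col₀ rowSum≡0 AF≡FS x)) ,
     Equivalence.from (w≤1⇔scaledWeight≤n T₊ x) (code⇒scaledWeight≤n T₊ code₊ x))
  (λ D3 →
     scaledWeight≤n⇒code T₊ (bound₊ D3) , scaledWeight≤n⇒code T₋ (bound₋ D3) ,
     F⋆ f , (λ _ → refl) , F⋆-rowSum f , F⋆-rowNonzeros≤2 T₊ T₋ disjoint (bound₊ D3) (bound₋ D3) ,
     F⋆-eigenmatrix 2≤q f (λ x → Equivalence.from (balance≡0⇔scaledWeight≡ T₊ T₋ disjoint x) (equal D3 x)))
  where
  f : Vertex (suc m) q → ℚ
  f = charFun T₊ T₋

  2≤q : 2 ≤ q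
  2≤q = ℕP.≤-trans (s≤s (s≤s z≤n)) 3≤q

  WeightConditions : Set
  WeightConditions = ∀ x → (w T₊ x ≡ w T₋ x) × (w T₊ x ≤ℚ 1ℚ)

  equal : WeightConditions → ∀ x → scaledWeight T₊ x ≡ scaledWeight T₋ x
  equal D3 x = Equivalence.to (w≡w⇔scaledWeight≡ T₊ T₋ x) (proj₁ (D3 x))

  bound₊ : WeightConditions → ∀ x → scaledWeight T₊ x ≤ suc m
  bound₊ D3 x = Equivalence.to (w≤1⇔scaledWeight≤n T₊ x) (proj₂ (D3 x))

  bound₋ : WeightConditions → ∀ x → scaledWeight T₋ x ≤ suc m
  bound₋ D3 x = subst (_≤ suc m) (equal D3 x) (bound₊ D3 x)
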